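{- Let $k,a,b,r$ be integers with $k\geq b>a\geq 1$ and $r\geq 1$. The set $\mathcal{P}'_{a,b,k,r}$ of partitions $(\pi_1,\ldots,\pi_m)$ whose parts are all congruent to $a$ or $b$ modulo $k$ and for which there is no index $i$ with $\pi_i,\pi_{i+1},\ldots,\pi_{i+r}$ all congruent to $a$ modulo $k$ is a separable integer partition class with modulus $k$.
   Context: Partitions are non-increasing finite sequences of positive integers. For a positive integer $k$, a separable integer partition class $\mathcal{P}$ with modulus $k$ is a set of partitions for which there is a subset $\mathcal{B}\subset\mathcal{P}$ (the basis) such that for each $m\geq 1$ the number of partitions in $\mathcal{B}$ with $m$ parts is finite, every partition in $\mathcal{P}$ with $m$ parts is uniquely of the form $(b_1+\pi_1,\ldots,b_m+\pi_m)$ where $(b_1,\ldots,b_m)\in\mathcal{B}$ and $(\pi_1,\ldots,\pi_m)$ is a non-increasing sequence of nonnegative integers each divisible by $k$, and all partitions of this form lie in $\mathcal{P}$. -}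

module Defs where

open import Data.Nat using (ℕ; suc; _+_; _≤_; _≥_; _<_; ∣_-_∣)
open import Data.Nat.Divisibility using (_∣_)
open import Data.List using (List; []; _∷_; length; zipWith; _++_)
open import Data.List.Relation.Unary.All using (All)
open import Data.List.Relation.Unary.Linked using (Linked)
open import Data.List.Membership.Propositional using (_∈_)
open import Data.Product using (Σ; ∃; _×_; _,_)
open import Data.Sum using (_⊎_)
open import Relation.Binary.PropositionalEquality using (_≡_)
open import Relation.Nullary using (¬_)
open import Function.Bundles using (_⇔_)

IsPartition : List ℕ → Set
IsPartition xs = Linked _≥_ xs × All (λ x → 1 ≤ x) xs

ModEq : ℕ → ℕ → ℕ → Set
ModEq k x y = k ∣ ∣ x - y ∣

Shift : ℕ → List ℕ → List ℕ → Set
Shift k b π = length π ≡ length b × Linked _≥_ π × All (λ p → k ∣ p) π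

record IsSeparable (k : ℕ) (P : List ℕ → Set) : Set₁ where
  field
    partitions : ∀ x → P x → IsPartition x
    B          : List ℕ → Set
    B⊆P        : ∀ x → B x → P x
    finite     : ∀ m → 1 ≤ m → ∃ λ (L : List (List ℕ)) →
                   ∀ x → length x ≡ m → (B x ⇔ x ∈ L)
    decomp     : ∀ x → P x → 1 ≤ length x →
                   Σ (List ℕ) λ b → Σ (List ℕ) λ π →
                     B b × Shift k b π × zipWith _+_ b π ≡ x
    unique     : ∀ b π b′ π′ → B b → Shift k b π → B b′ → Shift k b′ π′ →
                   1 ≤ length b → zipWith _+_ b π ≡ zipWith _+_ b′ π′ →
                   b ≡ b′ × π ≡ π′
    closed     : ∀ b π → B b → Shift k b π → 1 ≤ length b → P (zipWith _+_ b π)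

P′ : ℕ → ℕ → ℕ → ℕ → List ℕ → Set
P′ a b k r xs =
  IsPartition xs ×
  All (λ x → ModEq k x a ⊎ ModEq k x b) xs ×
  ¬ (Σ (List ℕ) λ us → Σ (List ℕ) λ zs → Σ (List ℕ) λ ws →
       xs ≡ us ++ zs ++ ws × length zs ≡ suc r × All (λ z → ModEq k z a) zs)

{-# OPTIONS --safe #-}
module Submission where

-- Every part is a + q k or b + q k for a unique colour (a or b) and level q ≥ 0.
-- For a fixed colour word the least partition with those colours takes the
-- lowest admissible levels: the level only has to rise, by one, where an a-part
-- is followed by a b-part, since a < b.  Whether a partition has r + 1
-- consecutive parts ≡ a depends only on its colour word, so the basis consists
-- of these least partitions for the run-free words (finitely many of each
-- length), and any partition is its least partition plus k times the
-- (non-increasing) excess of its levels over the lowest ones.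

open import Defs
open import Data.Nat using (ℕ; zero; suc; _+_; _*_; _∸_; _≤_; _<_; _≥_; z≤n; s≤s⁻¹; >-nonZero)
open import Data.Nat.Properties
open import Data.Nat.Divisibility using (_∣_; divides; ∣⇒≤)
open import Data.List using (List; []; _∷_; [_]; length; zipWith; _++_; map; filter)
open import Data.List.Properties using (∷-injective)
open import Data.List.Relation.Unary.All using (All; []; _∷_)
open import Data.List.Relation.Unary.Linked as Linked using (Linked; []; [-]; _∷_)
open import Data.List.Relation.Binary.Pointwise as Pointwise using (Pointwise; []; _∷_)
open import Data.List.Membership.Propositional using (_∈_)
open import Data.List.Membership.Propositional.Properties
  using (∈-map⁺; ∈-map⁻; ∈-++⁺ˡ; ∈-++⁺ʳ; ∈-filter⁺; ∈-filter⁻)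
open import Data.List.Relation.Unary.Any using (here)
open import Data.Product using (Σ; ∃-syntax; _×_; _,_; proj₁; proj₂; uncurry)
open import Data.Sum using (_⊎_; inj₁; inj₂)
open import Data.Empty using (⊥-elim)
open import Function using (_∘_)
open import Function.Bundles using (_⇔_; mk⇔; Equivalence)
open import Relation.Binary.PropositionalEquality using (_≡_; refl; sym; trans; cong; cong₂; subst)
open import Relation.Nullary using (¬_; yes; no; ¬?)
open import Relation.Nullary.Decidable using (map′; _×-dec_; _⊎-dec_)
open import Relation.Unary using (Decidable)

private variable
  X Y : Set
  P Q : X → Set
  n : ℕ
  xs ys : List X

HasRun : (X → Set) → ℕ → List X → Set
HasRun P n xs = Σ (List _) λ us → Σ (List _) λ zs → Σ (List _) λ ws →
  xs ≡ us ++ zs ++ ws × length zs ≡ n × All P zs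

RunAtStart : (X → Set) → ℕ → List X → Set
RunAtStart P n xs = Σ (List _) λ zs → Σ (List _) λ ws →
  xs ≡ zs ++ ws × length zs ≡ n × All P zs

runAtStart-transport : Pointwise (λ x y → P x → Q y) xs ys →
                       RunAtStart P n xs → RunAtStart Q n ys
runAtStart-transport {ys = ys} _ ([] , _ , refl , len , []) = [] , ys , refl , len , []
runAtStart-transport {n = suc _} (P⇒Q ∷ rel) (_ ∷ zs , ws , refl , len , Pz ∷ Pzs)
  with runAtStart-transport rel (zs , ws , refl , suc-injective len , Pzs)
... | zs′ , ws′ , refl , len′ , Qzs′ = _ ∷ zs′ , ws′ , refl , cong suc len′ , P⇒Q Pz ∷ Qzs′

hasRun-transport : Pointwise (λ x y → P x → Q y) xs ys → HasRun P n xs → HasRun Q n ys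
hasRun-transport rel ([] , start) = [] , runAtStart-transport rel start
hasRun-transport (_ ∷ rel) (_ ∷ us , zs , ws , refl , run)
  with hasRun-transport rel (us , zs , ws , refl , run)
... | us′ , zs′ , ws′ , refl , run′ = _ ∷ us′ , zs′ , ws′ , refl , run′

runAtStart? : Decidable P → ∀ n → Decidable (RunAtStart P n)
runAtStart? P? zero xs = yes ([] , xs , refl , refl , [])
runAtStart? P? (suc n) [] = no λ { ([] , _ , _ , () , _) ; (_ ∷ _ , _ , () , _) }
runAtStart? {P = P} P? (suc n) (x ∷ xs) = map′ cons uncons (P? x ×-dec runAtStart? P? n xs)
  where
  cons : P x × RunAtStart P n xs → RunAtStart P (suc n) (x ∷ xs)
  cons (Px , zs , ws , refl , len , Pzs) = x ∷ zs , ws , refl , cong suc len , Px ∷ Pzs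
  uncons : RunAtStart P (suc n) (x ∷ xs) → P x × RunAtStart P n xs
  uncons (_ ∷ zs , ws , refl , len , Px ∷ Pzs) = Px , zs , ws , refl , suc-injective len , Pzs

hasRun? : Decidable P → ∀ n → Decidable (HasRun P n)
hasRun? P? n [] = map′ ([] ,_) at-[] (runAtStart? P? n [])
  where
  at-[] : HasRun _ n [] → RunAtStart _ n []
  at-[] ([] , start) = start
hasRun? {P = P} P? n (x ∷ xs) = map′ join split (runAtStart? P? n (x ∷ xs) ⊎-dec hasRun? P? n xs)
  where
  join : RunAtStart P n (x ∷ xs) ⊎ HasRun P n xs → HasRun P n (x ∷ xs)
  join (inj₁ start) = [] , start
  join (inj₂ (us , zs , ws , refl , run)) = x ∷ us , zs , ws , refl , run
  split : HasRun P n (x ∷ xs) → RunAtStart P n (x ∷ xs) ⊎ HasRun P n xs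
  split ([] , start) = inj₁ start
  split (_ ∷ us , zs , ws , refl , run) = inj₂ (us , zs , ws , refl , run)

Pointwise⇒Allʳ : ∀ {R : X → Y → Set} → (∀ {x y} → R x y → Q y) →
                 Pointwise R xs ys → All Q ys
Pointwise⇒Allʳ R⇒Q []           = []
Pointwise⇒Allʳ R⇒Q (Rxy ∷ Rxys) = R⇒Q Rxy ∷ Pointwise⇒Allʳ R⇒Q Rxys

Pointwise-uniqueˡ : ∀ {R : X → Y → Set} → (∀ {x x′ y} → R x y → R x′ y → x ≡ x′) →
                    ∀ {xs xs′ ys} → Pointwise R xs ys → Pointwise R xs′ ys → xs ≡ xs′
Pointwise-uniqueˡ unique [] [] = refl
Pointwise-uniqueˡ unique (Rxy ∷ Rxys) (Rx′y ∷ Rxys′) =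
  cong₂ _∷_ (unique Rxy Rx′y) (Pointwise-uniqueˡ unique Rxys Rxys′)

zipWith-+-linked : ∀ {xs ys : List ℕ} → Linked _≥_ xs → Linked _≥_ ys →
                   Linked _≥_ (zipWith _+_ xs ys)
zipWith-+-linked []       _         = []
zipWith-+-linked [-]      []        = []
zipWith-+-linked [-]      [-]       = [-]
zipWith-+-linked [-]      (_ ∷ _)   = [-]
zipWith-+-linked (_ ∷ _)  []        = []
zipWith-+-linked (_ ∷ _)  [-]       = [-]
zipWith-+-linked (x≥ ∷ l) (y≥ ∷ l′) = +-mono-≤ x≥ y≥ ∷ zipWith-+-linked l l′

zipWith-+-cancelˡ : ∀ {xs ys zs : List ℕ} → length ys ≡ length xs → length zs ≡ length xs →
                    zipWith _+_ xs ys ≡ zipWith _+_ xs zs → ys ≡ zs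
zipWith-+-cancelˡ {[]}    {[]}    {[]}    _   _    _ = refl
zipWith-+-cancelˡ {x ∷ _} {y ∷ _} {z ∷ _} len len′ e =
  cong₂ _∷_ (+-cancelˡ-≡ x y z (proj₁ (∷-injective e)))
            (zipWith-+-cancelˡ (suc-injective len) (suc-injective len′) (proj₂ (∷-injective e)))

modEq-+-multiple : ∀ k c q → ModEq k (c + q * k) c
modEq-+-multiple k c q = divides q (trans (m≤n⇒∣n-m∣≡n∸m (m≤m+n c (q * k))) (m+n∸m≡n c (q * k)))

modEq⇒+-multiple : ∀ {k x c} → 1 ≤ x → c ≤ k → ModEq k x c → ∃[ q ] x ≡ c + q * k
modEq⇒+-multiple {k} {x} {c} 1≤x c≤k (divides q eq) with ≤-<-connex c x
... | inj₁ c≤x = q , trans (sym (m+[n∸m]≡n c≤x)) (cong (c +_) (trans (sym (m≤n⇒∣n-m∣≡n∸m c≤x)) eq))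
... | inj₂ x<c = ⊥-elim (<⇒≱ (≤-trans c∸x<c c≤k) k≤c∸x)
  where
  c∸x<c : c ∸ x < c
  c∸x<c = ∸-monoʳ-< 1≤x (<⇒≤ x<c)
  k≤c∸x : k ≤ c ∸ x
  k≤c∸x = ∣⇒≤ {{>-nonZero (m<n⇒0<n∸m x<c)}} (divides q (trans (sym (m≤n⇒∣m-n∣≡n∸m (<⇒≤ x<c))) eq))

+*k-cancel-≤ : ∀ {k x y q q′} → x ≤ k → 1 ≤ y → y + q′ * k ≤ x + q * k → q′ ≤ q
+*k-cancel-≤ {k} {x} {y} {q} {q′} x≤k 1≤y h = s≤s⁻¹ (*-cancelʳ-< k q′ (suc q) (begin-strict
  q′ * k     <⟨ m<n+m (q′ * k) 1≤y ⟩
  y + q′ * k ≤⟨ h ⟩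
  x + q * k  ≤⟨ +-monoˡ-≤ (q * k) x≤k ⟩
  suc q * k  ∎))
  where open ≤-Reasoning

+*k-cancel-< : ∀ {k x y q q′} → x < y → y + q′ * k ≤ x + q * k → q′ < q
+*k-cancel-< {k} {x} {y} {q} {q′} x<y h = *-cancelʳ-< k q′ q (+-cancelˡ-< y _ _ (begin-strict
  y + q′ * k ≤⟨ h ⟩
  x + q * k  <⟨ +-monoˡ-< (q * k) x<y ⟩
  y + q * k  ∎))
  where open ≤-Reasoning

data Colour : Set where
  A B : Colour

isA? : Decidable (_≡ A)
isA? A = yes refl
isA? B = no λ ()

words : ℕ → List (List Colour)
words zero    = [ [] ]
words (suc m) = map (A ∷_) (words m) ++ map (B ∷_) (words m)

∈-words : ∀ s → s ∈ words (length s)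
∈-words []      = here refl
∈-words (A ∷ s) = ∈-++⁺ˡ (∈-map⁺ (A ∷_) (∈-words s))
∈-words (B ∷ s) = ∈-++⁺ʳ (map (A ∷_) (words (length s))) (∈-map⁺ (B ∷_) (∈-words s))

module ColouredParts (k a b : ℕ) (1≤a : 1 ≤ a) (a<b : a < b) (b≤k : b ≤ k) where

  a≤k : a ≤ k
  a≤k = <⇒≤ (<-≤-trans a<b b≤k)

  1≤b : 1 ≤ b
  1≤b = ≤-trans 1≤a (<⇒≤ a<b)

  residue : Colour → ℕ
  residue A = a
  residue B = b

  part : Colour → ℕ → ℕ
  part c q = residue c + q * k

  gap : Colour → Colour → ℕ
  gap A B = 1
  gap _ _ = 0

  part-≤⇒gap : ∀ c c′ q q′ → part c′ q′ ≤ part c q → gap c c′ + q′ ≤ q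
  part-≤⇒gap A A _ _ = +*k-cancel-≤ a≤k 1≤a
  part-≤⇒gap A B _ _ = +*k-cancel-< a<b
  part-≤⇒gap B A _ _ = +*k-cancel-≤ b≤k 1≤a
  part-≤⇒gap B B _ _ = +*k-cancel-≤ b≤k 1≤b

  part-≤-gap : ∀ c c′ q → part c′ q ≤ part c (gap c c′ + q)
  part-≤-gap A A q = ≤-refl
  part-≤-gap A B q = ≤-trans (+-monoˡ-≤ (q * k) b≤k) (m≤n+m (k + q * k) a)
  part-≤-gap B A q = +-monoˡ-≤ (q * k) (<⇒≤ a<b)
  part-≤-gap B B q = ≤-refl

  part-injectiveˡ : ∀ {c c′ q q′} → part c q ≡ part c′ q′ → c ≡ c′
  part-injectiveˡ {A} {A} e = refl
  part-injectiveˡ {B} {B} e = refl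
  part-injectiveˡ {A} {B} {q} {q′} e =
    ⊥-elim (<⇒≱ (part-≤⇒gap A B q q′ (≤-reflexive (sym e))) (part-≤⇒gap B A q′ q (≤-reflexive e)))
  part-injectiveˡ {B} {A} {q} {q′} e =
    ⊥-elim (<⇒≱ (part-≤⇒gap A B q′ q (≤-reflexive e)) (part-≤⇒gap B A q q′ (≤-reflexive (sym e))))

  part-+-multiple : ∀ c q j → part c q + j * k ≡ part c (q + j)
  part-+-multiple c q j = trans (+-assoc (residue c) (q * k) (j * k)) (cong (residue c +_) (sym (*-distribʳ-+ k q j)))

  HasColour : Colour → ℕ → Set
  HasColour c x = ∃[ q ] x ≡ part c q

  colour-unique : ∀ {c c′ x} → HasColour c x → HasColour c′ x → c ≡ c′
  colour-unique (q , refl) (q′ , e) = part-injectiveˡ {q = q} {q′ = q′} e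

  decode : ∀ {x} → 1 ≤ x → ModEq k x a ⊎ ModEq k x b → ∃[ c ] HasColour c x
  decode 1≤x (inj₁ x≡a) = A , modEq⇒+-multiple 1≤x a≤k x≡a
  decode 1≤x (inj₂ x≡b) = B , modEq⇒+-multiple 1≤x b≤k x≡b

  HasColour⇒positive : ∀ {c x} → HasColour c x → 1 ≤ x
  HasColour⇒positive {A} (q , refl) = ≤-trans 1≤a (m≤m+n a (q * k))
  HasColour⇒positive {B} (q , refl) = ≤-trans 1≤b (m≤m+n b (q * k))

  HasColour⇒residue : ∀ {c x} → HasColour c x → ModEq k x a ⊎ ModEq k x b
  HasColour⇒residue {A} (q , refl) = inj₁ (modEq-+-multiple k a q)
  HasColour⇒residue {B} (q , refl) = inj₂ (modEq-+-multiple k b q)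

  ≡a⇔A : ∀ {c x} → HasColour c x → (ModEq k x a ⇔ c ≡ A)
  ≡a⇔A {A} (q , refl) = mk⇔ (λ _ → refl) (λ _ → modEq-+-multiple k a q)
  ≡a⇔A {B} hc@(q , refl) =
    mk⇔ (λ x≡a → let q′ , e = modEq⇒+-multiple (HasColour⇒positive hc) a≤k x≡a
                 in part-injectiveˡ {q = q} {q′ = q′} e)
        λ ()

  hasRun-colours : ∀ {n s xs} → Pointwise HasColour s xs →
                   HasRun (λ x → ModEq k x a) n xs ⇔ HasRun (_≡ A) n s
  hasRun-colours h = mk⇔
    (hasRun-transport (Pointwise.symmetric (λ hc → Equivalence.to (≡a⇔A hc)) h))
    (hasRun-transport (Pointwise.map (λ hc → Equivalence.from (≡a⇔A hc)) h))

  coloured⇒P′ : ∀ r {s xs} → Pointwise HasColour s xs → Linked _≥_ xs →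
                ¬ HasRun (_≡ A) (suc r) s → P′ a b k r xs
  coloured⇒P′ r h lnk noRun =
    (lnk , Pointwise⇒Allʳ HasColour⇒positive h) ,
    Pointwise⇒Allʳ HasColour⇒residue h ,
    noRun ∘ Equivalence.to (hasRun-colours h)

  +multiple-coloured : ∀ {s xs π} → Pointwise HasColour s xs → length π ≡ length xs →
                       All (k ∣_) π → Pointwise HasColour s (zipWith _+_ xs π)
  +multiple-coloured [] _ _ = []
  +multiple-coloured {c ∷ _} ((q , refl) ∷ h) len (divides j refl ∷ dv) =
    (q + j , part-+-multiple c q j) ∷ +multiple-coloured h (suc-injective len) dv

  level : Colour → List Colour → ℕ
  level c []       = 0
  level c (c′ ∷ s) = gap c c′ + level c′ s

  basis : List Colour → List ℕ
  basis []      = []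
  basis (c ∷ s) = part c (level c s) ∷ basis s

  basis-length : ∀ s → length (basis s) ≡ length s
  basis-length []      = refl
  basis-length (c ∷ s) = cong suc (basis-length s)

  basis-linked : ∀ s → Linked _≥_ (basis s)
  basis-linked []           = []
  basis-linked (c ∷ [])     = [-]
  basis-linked (c ∷ c′ ∷ s) = part-≤-gap c c′ (level c′ s) ∷ basis-linked (c′ ∷ s)

  basis-coloured : ∀ s → Pointwise HasColour s (basis s)
  basis-coloured []      = []
  basis-coloured (c ∷ s) = (level c s , refl) ∷ basis-coloured s

  parts : List (Colour × ℕ) → List ℕ
  parts = map (uncurry part)

  colours : List (Colour × ℕ) → List Colour
  colours = map proj₁

  parts-coloured : ∀ ds → Pointwise HasColour (colours ds) (parts ds)
  parts-coloured []             = []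
  parts-coloured ((_ , q) ∷ ds) = (q , refl) ∷ parts-coloured ds

  decodeAll : ∀ {xs} → All (1 ≤_) xs → All (λ x → ModEq k x a ⊎ ModEq k x b) xs →
              ∃[ ds ] xs ≡ parts ds
  decodeAll [] [] = [] , refl
  decodeAll (1≤x ∷ pos) (res ∷ ress) with decode 1≤x res | decodeAll pos ress
  ... | c , q , refl | ds , refl = (c , q) ∷ ds , refl

  shift : List (Colour × ℕ) → List ℕ
  shift []             = []
  shift ((c , q) ∷ ds) = (q ∸ level c (colours ds)) * k ∷ shift ds

  level-≤ : ∀ c q ds → Linked _≥_ (parts ((c , q) ∷ ds)) → level c (colours ds) ≤ q
  level-≤ c q []              _        = z≤n
  level-≤ c q ((c′ , q′) ∷ ds) (h ∷ l) = begin
    gap c c′ + level c′ (colours ds) ≤⟨ +-monoʳ-≤ (gap c c′) (level-≤ c′ q′ ds l) ⟩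
    gap c c′ + q′                    ≤⟨ part-≤⇒gap c c′ q q′ h ⟩
    q                                ∎
    where open ≤-Reasoning

  shift-linked : ∀ ds → Linked _≥_ (parts ds) → Linked _≥_ (shift ds)
  shift-linked []                         _       = []
  shift-linked (_ ∷ [])                   _       = [-]
  shift-linked ((c , q) ∷ (c′ , q′) ∷ ds) (h ∷ l) =
    *-monoˡ-≤ k excess-≤ ∷ shift-linked ((c′ , q′) ∷ ds) l
    where
    open ≤-Reasoning
    L = level c′ (colours ds)
    excess-≤ : q′ ∸ L ≤ q ∸ (gap c c′ + L)
    excess-≤ = begin
      q′ ∸ L                           ≡⟨ [m+n]∸[m+o]≡n∸o (gap c c′) q′ L ⟨
      (gap c c′ + q′) ∸ (gap c c′ + L) ≤⟨ ∸-monoˡ-≤ (gap c c′ + L) (part-≤⇒gap c c′ q q′ h) ⟩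
      q ∸ (gap c c′ + L)               ∎

  shift-length : ∀ ds → length (shift ds) ≡ length (basis (colours ds))
  shift-length []       = refl
  shift-length (_ ∷ ds) = cong suc (shift-length ds)

  shift-divisible : ∀ ds → All (k ∣_) (shift ds)
  shift-divisible []             = []
  shift-divisible ((c , q) ∷ ds) = divides (q ∸ level c (colours ds)) refl ∷ shift-divisible ds

  basis+shift≡parts : ∀ ds → Linked _≥_ (parts ds) → zipWith _+_ (basis (colours ds)) (shift ds) ≡ parts ds
  basis+shift≡parts []             _ = refl
  basis+shift≡parts ((c , q) ∷ ds) l =
    cong₂ _∷_ head (basis+shift≡parts ds (Linked.tail l))
    where
    L = level c (colours ds)
    head : part c L + (q ∸ L) * k ≡ part c q
    head = trans (part-+-multiple c L (q ∸ L)) (cong (part c) (m+[n∸m]≡n (level-≤ c q ds l)))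

  Basis : ℕ → List ℕ → Set
  Basis r y = ∃[ s ] ¬ HasRun (_≡ A) (suc r) s × y ≡ basis s

  runFree? : ∀ r → Decidable (λ s → ¬ HasRun (_≡ A) (suc r) s)
  runFree? r = ¬? ∘ hasRun? isA? (suc r)

  basisOfLength : ℕ → ℕ → List (List ℕ)
  basisOfLength r m = map basis (filter (runFree? r) (words m))

  basis-finite : ∀ r m y → length y ≡ m → Basis r y ⇔ y ∈ basisOfLength r m
  basis-finite r m y len = mk⇔ to from
    where
    to : Basis r y → y ∈ basisOfLength r m
    to (s , free , refl) = ∈-map⁺ basis (∈-filter⁺ (runFree? r) s∈words free)
      where
      s∈words : s ∈ words m
      s∈words = subst (λ n → s ∈ words n) (trans (sym (basis-length s)) len) (∈-words s)
    from : y ∈ basisOfLength r m → Basis r y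
    from mem with ∈-map⁻ basis mem
    ... | s , s∈ , refl = s , proj₂ (∈-filter⁻ (runFree? r) {xs = words m} s∈) , refl

  decomposition : ∀ r x → P′ a b k r x → 1 ≤ length x →
                  Σ (List ℕ) λ y → Σ (List ℕ) λ π → Basis r y × Shift k y π × zipWith _+_ y π ≡ x
  decomposition r x ((lnk , pos) , res , noRun) _ with decodeAll pos res
  ... | ds , refl =
    basis (colours ds) , shift ds ,
    (colours ds , noRun ∘ Equivalence.from (hasRun-colours (parts-coloured ds)) , refl) ,
    (shift-length ds , shift-linked ds lnk , shift-divisible ds) ,
    basis+shift≡parts ds lnk

  uniqueness : ∀ r y π y′ π′ → Basis r y → Shift k y π → Basis r y′ → Shift k y′ π′ →
               1 ≤ length y → zipWith _+_ y π ≡ zipWith _+_ y′ π′ → y ≡ y′ × π ≡ π′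
  uniqueness r _ π _ π′ (s , _ , refl) (len , _ , dv) (s′ , _ , refl) (len′ , _ , dv′) _ sums
    with Pointwise-uniqueˡ colour-unique
           (+multiple-coloured (basis-coloured s) len dv)
           (subst (Pointwise HasColour s′) (sym sums) (+multiple-coloured (basis-coloured s′) len′ dv′))
  ... | refl = refl , zipWith-+-cancelˡ len len′ sums

  closure : ∀ r y π → Basis r y → Shift k y π → 1 ≤ length y → P′ a b k r (zipWith _+_ y π)
  closure r _ π (s , free , refl) (len , lnk , dv) _ =
    coloured⇒P′ r (+multiple-coloured (basis-coloured s) len dv) (zipWith-+-linked (basis-linked s) lnk) free

  isSeparable : ∀ r → IsSeparable k (P′ a b k r)
  isSeparable r = record
    { partitions = λ _ → proj₁
    ; B          = Basis r
    ; B⊆P        = λ { _ (s , free , refl) → coloured⇒P′ r (basis-coloured s) (basis-linked s) free }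
    ; finite     = λ m _ → basisOfLength r m , basis-finite r m
    ; decomp     = decomposition r
    ; unique     = uniqueness r
    ; closed     = closure r
    }

theorem3p5 : (k a b r : ℕ) → b ≤ k → a < b → 1 ≤ a → 1 ≤ r →
    IsSeparable k (P′ a b k r)
theorem3p5 k a b r b≤k a<b 1≤a _ = ColouredParts.isSeparable k a b 1≤a a<b b≤k r
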